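{- Let $\mathbb{F}_q$ be a finite field, $P,Q\in\mathbb{F}_q[X]\setminus\{0\}$ coprime with $\deg P>\deg Q$ and $\mathcal{D}=\{s\in\mathbb{F}_q[X]:\deg s<\deg P\}$. For every $m\ge0$, the function $s^{(m)}:\mathbb{F}_q[X]\to\mathcal{D}$ is $\mathbb{F}_q$-automatic.
   Context: For $w\in\mathbb{F}_q[X]$ put $w_0=w$ and for $i\ge 0$ let $s_i\in\mathcal{D}$ be the remainder of $Qw_i$ upon division by $P$ and $w_{i+1}=(Qw_i-s_i)/P$; let $k\ge 0$ be minimal with $w_i=0$ for all $i>k$. Then $w=\sum_{i=0}^k\frac{s_i}{Q}(P/Q)^i$ is the $P/Q$-polynomial digit expansion of $w$. Define $s^{(m)}(w)=s_m$ if $m\le k$ and $s^{(m)}(w)=0$ otherwise. A DFAO (deterministic finite automaton with output) is a finite automaton with an initial state, a transition function, and an output function on states with values in a finite set; its output on an input word is the value of the output function at the state reached. A function $f:\mathbb{F}_q[X]\to\Delta$ ($\Delta$ finite) is $\mathbb{F}_q$-automatic if some DFAO with input alphabet $\mathbb{F}_q$ outputs $f(w)$ on input the coefficient word $w_k\cdots w_0$ of $w=\sum_{i=0}^k w_iX^i$ (read starting from $w_0$). -}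

module Defs where

open import Data.Nat as ℕ using (ℕ; zero; suc; _∸_; _<_; _<?_)
open import Data.Fin using (Fin)
open import Data.List using (List; []; _∷_; length; foldl; replicate; map; _++_)
open import Data.Bool using (Bool; true; false; not; T; if_then_else_)
open import Data.Unit using (tt)
open import Data.Product using (Σ; _,_; proj₁; proj₂; ∃; _×_)
open import Relation.Nullary using (¬_; yes; no)
open import Relation.Nullary.Decidable using (⌊_⌋)
open import Relation.Binary.PropositionalEquality using (_≡_; _≢_; subst; sym)
open import Relation.Binary.Definitions using (DecidableEquality)
open import Algebra.Structures using (IsCommutativeRing)
open import Function.Bundles using (_↔_)

-- A finite field F_q, presented with propositional equality as its
-- equality (every finite field is isomorphic to one of this form).

record FiniteField : Set₁ where
  field
    Carrier           : Set
    _+_ _*_           : Carrier → Carrier → Carrier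
    -_                : Carrier → Carrier
    0# 1#             : Carrier
    isCommutativeRing : IsCommutativeRing _≡_ _+_ _*_ -_ 0# 1#
    0≢1               : 0# ≢ 1#
    _⁻¹               : Carrier → Carrier
    *-inverse         : ∀ x → x ≢ 0# → x * (x ⁻¹) ≡ 1#
    _≟_               : DecidableEquality Carrier
    q                 : ℕ
    enumeration       : Carrier ↔ Fin q

module Polynomials (𝔽 : FiniteField) where
  open FiniteField 𝔽 renaming (Carrier to C)

  isZero : C → Bool
  isZero x = ⌊ x ≟ 0# ⌋

  -- a coefficient list (lowest degree first) is normalised iff it is
  -- empty or its last (= leading) coefficient is nonzero
  normal : List C → Bool
  normal []           = true
  normal (x ∷ [])     = not (isZero x)
  normal (x ∷ y ∷ ys) = normal (y ∷ ys)

  trim : List C → List C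
  trim [] = []
  trim (x ∷ xs) with trim xs
  ... | []     = if isZero x then [] else x ∷ []
  ... | y ∷ ys = x ∷ y ∷ ys

  private
    trimIf : ∀ x → T (normal (if isZero x then [] else x ∷ []))
    trimIf x with isZero x in eq
    ... | true  = tt
    ... | false = subst (λ b → T (not b)) (sym eq) tt

  trim-normal : ∀ xs → T (normal (trim xs))
  trim-normal [] = tt
  trim-normal (x ∷ xs) with trim xs | trim-normal xs
  ... | []     | _ = trimIf x
  ... | y ∷ ys | p = p

  -- a polynomial  w = Σ_{i<k+1} w_i X^i  is its normalised coefficient
  -- list  w_0 ∷ w_1 ∷ … ∷ w_k  (the zero polynomial is the empty list)
  record Poly : Set where
    constructor poly
    field
      coeffs   : List C
      isNormal : T (normal coeffs)
  open Poly public

  mk : List C → Poly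
  mk xs = poly (trim xs) (trim-normal xs)

  addR : List C → List C → List C
  addR []       ys       = ys
  addR (x ∷ xs) []       = x ∷ xs
  addR (x ∷ xs) (y ∷ ys) = (x + y) ∷ addR xs ys

  mulR : List C → List C → List C
  mulR []       ys = []
  mulR (x ∷ xs) ys = addR (map (x *_) ys) (0# ∷ mulR xs ys)

  lastR : List C → C
  lastR []           = 0#
  lastR (x ∷ [])     = x
  lastR (x ∷ y ∷ ys) = lastR (y ∷ ys)

  0p : Poly
  0p = poly [] tt

  _⊕_ : Poly → Poly → Poly
  p ⊕ r = mk (addR (coeffs p) (coeffs r))

  ⊝_ : Poly → Poly
  ⊝ p = mk (map -_ (coeffs p))

  _⊖_ : Poly → Poly → Poly
  p ⊖ r = p ⊕ (⊝ r)

  _⊛_ : Poly → Poly → Poly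
  p ⊛ r = mk (mulR (coeffs p) (coeffs r))

  -- leading coefficient, and  deg p + 1  (so that deg 0 = -∞ ↦ 0)
  lead : Poly → C
  lead p = lastR (coeffs p)

  len : Poly → ℕ
  len p = length (coeffs p)

  _deg<_ : Poly → Poly → Set
  p deg< r = len p < len r

  monomial : C → ℕ → Poly
  monomial c d = mk (replicate d 0# ++ (c ∷ []))

  -- The fuel  len a + 1  suffices since every
  -- step lowers the degree of the current remainder.
  divModAux : ℕ → Poly → Poly → Poly → Poly × Poly
  divModAux zero    b qu r = qu , r
  divModAux (suc f) b qu r with len r <? len b
  ... | yes _ = qu , r
  ... | no  _ =
    let t = monomial (lead r * (lead b ⁻¹)) (len r ∸ len b)
    in divModAux f b (qu ⊕ t) (r ⊖ (t ⊛ b))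

  divMod : Poly → Poly → Poly × Poly
  divMod a b = divModAux (suc (len a)) b 0p a

  quot rem : Poly → Poly → Poly
  quot a b = proj₁ (divMod a b)
  rem  a b = proj₂ (divMod a b)

  -- divisibility and coprimality: every common divisor is a unit,
  -- i.e. a nonzero constant (degree 0)
  _∣_ : Poly → Poly → Set
  d ∣ p = ∃ λ c → d ⊛ c ≡ p

  Coprime : Poly → Poly → Set
  Coprime p r = ∀ d → d ∣ p → d ∣ r → len d ≡ 1

  -- the P/Q digit expansion:  w_0 = w,  s_i = (Q w_i) mod P,
  -- w_{i+1} = (Q w_i - s_i)/P = (Q w_i) div P
  wSeq : (P Q w : Poly) → ℕ → Poly
  wSeq P Q w zero    = w
  wSeq P Q w (suc i) = quot (Q ⊛ wSeq P Q w i) P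

  sSeq : (P Q w : Poly) → ℕ → Poly
  sSeq P Q w i = rem (Q ⊛ wSeq P Q w i) P

  -- s^{(m)}(w).  (For m > k one has w_m = 0 and hence s_m = 0, so the
  -- paper's case distinction "s_m if m ≤ k, else 0" is just s_m.)
  digit : (P Q : Poly) → ℕ → Poly → Poly
  digit P Q m w = sSeq P Q w m

  record DFAO (Σ′ Δ : Set) : Set where
    field
      n      : ℕ
      init   : Fin n
      δ      : Fin n → Σ′ → Fin n
      output : Fin n → Δ

  run : ∀ {Σ′ Δ} → DFAO Σ′ Δ → List Σ′ → Δ
  run A word = DFAO.output A (foldl (DFAO.δ A) (DFAO.init A) word)

  -- F_q-automatic: the DFAO, fed the coefficient word w_k ⋯ w_0 read
  -- starting from w_0, outputs f w
  Automatic : ∀ {Δ} → (Poly → Δ) → Set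
  Automatic {Δ} f = Σ (DFAO C Δ) λ A → ∀ w → run A (coeffs w) ≡ f w

module Submission where

open import Defs
open import Data.Nat using (ℕ)
open import Relation.Binary.PropositionalEquality using (_≢_)

open import Data.Nat as ℕ using (zero; suc; _≤_; _<_; _∸_; z≤n; s≤s; _<?_; pred)
import Data.Nat.Properties as ℕₚ
open import Data.List using (List; []; _∷_; length; foldl; replicate; map; _++_)
open import Data.Vec as Vec using (Vec; toList)
open import Data.Bool using (true; false; T; not)
open import Data.Bool.Properties using (T-irrelevant)
open import Data.Unit using (⊤; tt)
open import Data.Empty using (⊥; ⊥-elim)
open import Data.Sum using (inj₁; inj₂)
open import Data.Product using (_,_; proj₁; proj₂; _×_)
open import Data.Fin as Fin using (Fin)
import Data.Fin.Properties as Finₚ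
open import Relation.Nullary using (¬_; Dec; yes; no)
open import Relation.Binary.PropositionalEquality
  using (_≡_; refl; sym; trans; cong; cong₂; subst; isEquivalence; module ≡-Reasoning)
open import Algebra.Bundles using (CommutativeRing)
open import Algebra.Structures using (IsCommutativeRing)
open import Function.Bundles using (Inverse; _↔_)
import Algebra.Solver.Ring.NaturalCoefficients.Default as SemiringSolver

-- Idea.  s^(m)(w) depends only on the residue of w modulo P^(m+1): if
-- w ≡ w' (mod P·P^m) then Q w ≡ Q w' (mod P·P^m), so by uniqueness of Euclidean
-- division Q w and Q w' have the same remainder modulo P (the digit s₀) and their
-- quotients w₁, w₁' are congruent modulo P^m; induction on m (digit-mod).
-- The residue of w = Σ w_i X^i modulo R = P^(m+1) is computed by a left fold
-- over w₀, w₁, … with state (X^i mod R, Σ_{j<i} w_j X^j mod R), a pair of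
-- coefficient vectors of length deg R, i.e. an element of a finite set.

-- Finite state sets.  A type is enumerable when it is a retract of some
-- Fin n; this is all a DFAO needs of its state set.
record Enumerable (S : Set) : Set where
  field
    size          : ℕ
    encode        : S → Fin size
    decode        : Fin size → S
    decode-encode : ∀ s → decode (encode s) ≡ s

enumerable-↔ : ∀ {S n} → S ↔ Fin n → Enumerable S
enumerable-↔ {n = n} S↔Fin = record
  { size = n ; encode = to ; decode = from ; decode-encode = strictlyInverseʳ }
  where open Inverse S↔Fin

enumerable-⊤ : Enumerable ⊤
enumerable-⊤ = record { size = 1 ; encode = λ _ → Fin.zero ; decode = λ _ → tt ; decode-encode = λ _ → refl }

enumerable-× : ∀ {S T} → Enumerable S → Enumerable T → Enumerable (S × T)
enumerable-× E F = record
  { size          = E.size ℕ.* F.size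
  ; encode        = λ (s , t) → Fin.combine (E.encode s) (F.encode t)
  ; decode        = λ i → let (j , k) = Fin.remQuot F.size i in E.decode j , F.decode k
  ; decode-encode = λ (s , t) →
      trans (cong (λ (j , k) → E.decode j , F.decode k) (Finₚ.remQuot-combine (E.encode s) (F.encode t)))
            (cong₂ _,_ (E.decode-encode s) (F.decode-encode t))
  }
  where
  module E = Enumerable E
  module F = Enumerable F

enumerable-retract : ∀ {S T} → Enumerable S → (f : S → T) (g : T → S) → (∀ t → f (g t) ≡ t) → Enumerable T
enumerable-retract E f g f∘g = record
  { size = size ; encode = λ t → encode (g t) ; decode = λ i → f (decode i)
  ; decode-encode = λ t → trans (cong f (decode-encode (g t))) (f∘g t) }
  where open Enumerable E

enumerable-Vec : ∀ {A} → Enumerable A → ∀ k → Enumerable (Vec A k)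
enumerable-Vec E zero    = enumerable-retract enumerable-⊤ (λ _ → Vec.[]) (λ _ → tt) λ { Vec.[] → refl }
enumerable-Vec E (suc k) = enumerable-retract (enumerable-× E (enumerable-Vec E k))
  (λ (x , xs) → x Vec.∷ xs) (λ xs → Vec.head xs , Vec.tail xs) λ { (x Vec.∷ xs) → refl }

module DigitAutomaticity (𝔽 : FiniteField) where
  open FiniteField 𝔽 using (isCommutativeRing; 0≢1; _⁻¹; *-inverse; _≟_; enumeration)
    renaming (Carrier to C)
  open Polynomials 𝔽

  F : CommutativeRing _ _
  F = record { isCommutativeRing = isCommutativeRing }
  open CommutativeRing F using (_+_; _*_; -_; 0#; 1#; +-comm; +-assoc; +-identityˡ; +-identityʳ;
    -‿inverseʳ; *-comm; *-assoc; *-identityˡ; *-identityʳ; zeroˡ; zeroʳ; distribˡ)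
  open import Algebra.Properties.Ring (CommutativeRing.ring F) using (-0#≈0#)

  module F-Solver = SemiringSolver (CommutativeRing.commutativeSemiring F)
  open F-Solver using (_:+_; _:*_; _:=_)
  open ≡-Reasoning

  *-nonzero : ∀ {a b} → a ≢ 0# → b ≢ 0# → a * b ≢ 0#
  *-nonzero {a} {b} a≢0 b≢0 ab≡0 = b≢0 (begin
    b                ≡⟨ trans (cong (_* b) (trans (*-comm (a ⁻¹) a) (*-inverse a a≢0))) (*-identityˡ b) ⟨
    (a ⁻¹ * a) * b   ≡⟨ *-assoc (a ⁻¹) a b ⟩
    a ⁻¹ * (a * b)   ≡⟨ cong (a ⁻¹ *_) ab≡0 ⟩
    a ⁻¹ * 0#        ≡⟨ zeroʳ _ ⟩
    0#               ∎)

  coef : List C → ℕ → C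
  coef []       n       = 0#
  coef (x ∷ xs) zero    = x
  coef (x ∷ xs) (suc n) = coef xs n

  coef-beyond : ∀ xs {n} → length xs ≤ n → coef xs n ≡ 0#
  coef-beyond []       _         = refl
  coef-beyond (x ∷ xs) (s≤s le) = coef-beyond xs le

  -- Lists with the same coefficients, i.e. equal up to trailing zeros.
  -- This is the equality under which the raw operations form a ring.
  infix 4 _≈_
  record _≈_ (xs ys : List C) : Set where
    constructor pointwise
    field at : ∀ n → coef xs n ≡ coef ys n
  open _≈_

  ≈-refl : ∀ {xs} → xs ≈ xs
  ≈-refl = pointwise λ _ → refl

  ≈-sym : ∀ {xs ys} → xs ≈ ys → ys ≈ xs
  ≈-sym e = pointwise λ n → sym (at e n)

  ≈-trans : ∀ {xs ys zs} → xs ≈ ys → ys ≈ zs → xs ≈ zs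
  ≈-trans e f = pointwise λ n → trans (at e n) (at f n)

  ∷-cong : ∀ {x xs ys} → xs ≈ ys → x ∷ xs ≈ x ∷ ys
  ∷-cong e = pointwise λ { zero → refl ; (suc n) → at e n }

  coef-addR : ∀ xs ys n → coef (addR xs ys) n ≡ coef xs n + coef ys n
  coef-addR []       ys       n       = sym (+-identityˡ _)
  coef-addR (x ∷ xs) []       n       = sym (+-identityʳ _)
  coef-addR (x ∷ xs) (y ∷ ys) zero    = refl
  coef-addR (x ∷ xs) (y ∷ ys) (suc n) = coef-addR xs ys n

  addR-cong : ∀ {a a' b b'} → a ≈ a' → b ≈ b' → addR a b ≈ addR a' b'
  addR-cong {a} {a'} {b} {b'} e f = pointwise λ n →
    trans (coef-addR a b n) (trans (cong₂ _+_ (at e n) (at f n)) (sym (coef-addR a' b' n)))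

  coef-map : ∀ (f : C → C) → f 0# ≡ 0# → ∀ xs n → coef (map f xs) n ≡ f (coef xs n)
  coef-map f f0 []       n       = sym f0
  coef-map f f0 (x ∷ xs) zero    = refl
  coef-map f f0 (x ∷ xs) (suc n) = coef-map f f0 xs n

  coef-scale : ∀ a xs n → coef (map (a *_) xs) n ≡ a * coef xs n
  coef-scale a = coef-map (a *_) (zeroʳ a)

  coef-mulR-∷ : ∀ x xs ys n → coef (mulR (x ∷ xs) ys) n ≡ x * coef ys n + coef (0# ∷ mulR xs ys) n
  coef-mulR-∷ x xs ys n =
    trans (coef-addR (map (x *_) ys) _ n) (cong (_+ coef (0# ∷ mulR xs ys) n) (coef-scale x ys n))

  coef-shift-addR : ∀ xs ys n → coef (0# ∷ addR xs ys) n ≡ coef (0# ∷ xs) n + coef (0# ∷ ys) n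
  coef-shift-addR xs ys zero    = sym (+-identityˡ 0#)
  coef-shift-addR xs ys (suc n) = coef-addR xs ys n

  coef-shift-scale : ∀ a xs n → coef (0# ∷ map (a *_) xs) n ≡ a * coef (0# ∷ xs) n
  coef-shift-scale a xs zero    = sym (zeroʳ a)
  coef-shift-scale a xs (suc n) = coef-scale a xs n

  mulR-congʳ : ∀ xs {ys ys'} → ys ≈ ys' → mulR xs ys ≈ mulR xs ys'
  mulR-congʳ []       e = ≈-refl
  mulR-congʳ (x ∷ xs) {ys} {ys'} e = pointwise λ n → begin
    coef (mulR (x ∷ xs) ys) n                   ≡⟨ coef-mulR-∷ x xs ys n ⟩
    x * coef ys n + coef (0# ∷ mulR xs ys) n    ≡⟨ cong₂ _+_ (cong (x *_) (at e n))
                                                     (at (∷-cong (mulR-congʳ xs e)) n) ⟩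
    x * coef ys' n + coef (0# ∷ mulR xs ys') n  ≡⟨ coef-mulR-∷ x xs ys' n ⟨
    coef (mulR (x ∷ xs) ys') n                  ∎

  mulR-zeroʳ : ∀ xs → mulR xs [] ≈ []
  mulR-zeroʳ []       = ≈-refl
  mulR-zeroʳ (x ∷ xs) = pointwise λ { zero → refl ; (suc n) → at (mulR-zeroʳ xs) n }

  mulR-∷ʳ : ∀ xs y ys → mulR xs (y ∷ ys) ≈ addR (map (_* y) xs) (0# ∷ mulR xs ys)
  mulR-∷ʳ []       y ys = pointwise λ { zero → refl ; (suc n) → refl }
  mulR-∷ʳ (x ∷ xs) y ys = pointwise λ { zero → refl ; (suc n) → tail n }
    where
    xys = coef (map (x *_) ys)
    xsy = coef (map (_* y) xs)
    tail : ∀ n → coef (addR (map (x *_) ys) (mulR xs (y ∷ ys))) n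
               ≡ coef (addR (map (_* y) xs) (addR (map (x *_) ys) (0# ∷ mulR xs ys))) n
    tail n = begin
      coef (addR (map (x *_) ys) (mulR xs (y ∷ ys))) n
        ≡⟨ coef-addR (map (x *_) ys) _ n ⟩
      xys n + coef (mulR xs (y ∷ ys)) n
        ≡⟨ cong (xys n +_) (trans (at (mulR-∷ʳ xs y ys) n) (coef-addR (map (_* y) xs) _ n)) ⟩
      xys n + (xsy n + coef (0# ∷ mulR xs ys) n)
        ≡⟨ F-Solver.solve 3 (λ a b c → (a :+ (b :+ c)) := (b :+ (a :+ c))) refl (xys n) _ _ ⟩
      xsy n + (xys n + coef (0# ∷ mulR xs ys) n)
        ≡⟨ cong (xsy n +_) (coef-addR (map (x *_) ys) _ n) ⟨
      xsy n + coef (addR (map (x *_) ys) (0# ∷ mulR xs ys)) n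
        ≡⟨ coef-addR (map (_* y) xs) _ n ⟨
      coef (addR (map (_* y) xs) (addR (map (x *_) ys) (0# ∷ mulR xs ys))) n ∎

  mulR-comm : ∀ xs ys → mulR xs ys ≈ mulR ys xs
  mulR-comm []       ys = ≈-sym (mulR-zeroʳ ys)
  mulR-comm (x ∷ xs) ys = ≈-trans
    (pointwise λ n → begin
      coef (mulR (x ∷ xs) ys) n                 ≡⟨ coef-mulR-∷ x xs ys n ⟩
      x * coef ys n + coef (0# ∷ mulR xs ys) n  ≡⟨ cong₂ _+_ (*-comm x _) (at (∷-cong (mulR-comm xs ys)) n) ⟩
      coef ys n * x + coef (0# ∷ mulR ys xs) n  ≡⟨ cong (_+ coef (0# ∷ mulR ys xs) n)
                                                     (coef-map (_* x) (zeroˡ x) ys n) ⟨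
      coef (map (_* x) ys) n + coef (0# ∷ mulR ys xs) n
                                                ≡⟨ coef-addR (map (_* x) ys) _ n ⟨
      coef (addR (map (_* x) ys) (0# ∷ mulR ys xs)) n ∎)
    (≈-sym (mulR-∷ʳ ys x xs))

  mulR-congˡ : ∀ {xs xs'} ys → xs ≈ xs' → mulR xs ys ≈ mulR xs' ys
  mulR-congˡ {xs} {xs'} ys e = ≈-trans (mulR-comm xs ys) (≈-trans (mulR-congʳ ys e) (mulR-comm ys xs'))

  mulR-distribʳ : ∀ xs xs' ys → mulR (addR xs xs') ys ≈ addR (mulR xs ys) (mulR xs' ys)
  mulR-distribʳ []       xs'       ys = ≈-refl
  mulR-distribʳ (x ∷ xs) []        ys = pointwise λ n → sym (trans (coef-addR (mulR (x ∷ xs) ys) [] n) (+-identityʳ _))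
  mulR-distribʳ (x ∷ xs) (x' ∷ xs') ys = pointwise λ n → begin
    coef (mulR ((x + x') ∷ addR xs xs') ys) n
      ≡⟨ coef-mulR-∷ (x + x') (addR xs xs') ys n ⟩
    (x + x') * coef ys n + coef (0# ∷ mulR (addR xs xs') ys) n
      ≡⟨ cong ((x + x') * coef ys n +_)
           (trans (at (∷-cong (mulR-distribʳ xs xs' ys)) n) (coef-shift-addR (mulR xs ys) (mulR xs' ys) n)) ⟩
    (x + x') * coef ys n + (coef (0# ∷ mulR xs ys) n + coef (0# ∷ mulR xs' ys) n)
      ≡⟨ F-Solver.solve 5 (λ a b y u v → ((a :+ b) :* y :+ (u :+ v)) := ((a :* y :+ u) :+ (b :* y :+ v)))
           refl x x' (coef ys n) _ _ ⟩
    (x * coef ys n + coef (0# ∷ mulR xs ys) n) + (x' * coef ys n + coef (0# ∷ mulR xs' ys) n)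
      ≡⟨ cong₂ _+_ (coef-mulR-∷ x xs ys n) (coef-mulR-∷ x' xs' ys n) ⟨
    coef (mulR (x ∷ xs) ys) n + coef (mulR (x' ∷ xs') ys) n
      ≡⟨ coef-addR (mulR (x ∷ xs) ys) _ n ⟨
    coef (addR (mulR (x ∷ xs) ys) (mulR (x' ∷ xs') ys)) n ∎

  mulR-scaleˡ : ∀ a ys zs → mulR (map (a *_) ys) zs ≈ map (a *_) (mulR ys zs)
  mulR-scaleˡ a []       zs = ≈-refl
  mulR-scaleˡ a (y ∷ ys) zs = pointwise λ n → begin
    coef (mulR ((a * y) ∷ map (a *_) ys) zs) n
      ≡⟨ coef-mulR-∷ (a * y) (map (a *_) ys) zs n ⟩
    (a * y) * coef zs n + coef (0# ∷ mulR (map (a *_) ys) zs) n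
      ≡⟨ cong₂ _+_ (*-assoc a y _)
           (trans (at (∷-cong (mulR-scaleˡ a ys zs)) n) (coef-shift-scale a (mulR ys zs) n)) ⟩
    a * (y * coef zs n) + a * coef (0# ∷ mulR ys zs) n
      ≡⟨ distribˡ a _ _ ⟨
    a * (y * coef zs n + coef (0# ∷ mulR ys zs) n)
      ≡⟨ cong (a *_) (coef-mulR-∷ y ys zs n) ⟨
    a * coef (mulR (y ∷ ys) zs) n
      ≡⟨ coef-scale a (mulR (y ∷ ys) zs) n ⟨
    coef (map (a *_) (mulR (y ∷ ys) zs)) n ∎

  mulR-shiftˡ : ∀ xs ys → mulR (0# ∷ xs) ys ≈ 0# ∷ mulR xs ys
  mulR-shiftˡ xs ys = pointwise λ n →
    trans (coef-mulR-∷ 0# xs ys n) (trans (cong (_+ coef (0# ∷ mulR xs ys) n) (zeroˡ _)) (+-identityˡ _))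

  mulR-assoc : ∀ xs ys zs → mulR (mulR xs ys) zs ≈ mulR xs (mulR ys zs)
  mulR-assoc []       ys zs = ≈-refl
  mulR-assoc (x ∷ xs) ys zs = ≈-trans (mulR-distribʳ (map (x *_) ys) (0# ∷ mulR xs ys) zs)
    (addR-cong (mulR-scaleˡ x ys zs) (≈-trans (mulR-shiftˡ (mulR xs ys) zs) (∷-cong (mulR-assoc xs ys zs))))

  mulR-constˡ : ∀ a ys → mulR (a ∷ []) ys ≈ map (a *_) ys
  mulR-constˡ a ys = pointwise λ n → begin
    coef (mulR (a ∷ []) ys) n        ≡⟨ coef-mulR-∷ a [] ys n ⟩
    a * coef ys n + coef (0# ∷ []) n ≡⟨ cong (a * coef ys n +_) (zero-list n) ⟩
    a * coef ys n + 0#               ≡⟨ +-identityʳ _ ⟩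
    a * coef ys n                    ≡⟨ coef-scale a ys n ⟨
    coef (map (a *_) ys) n           ∎
    where
    zero-list : ∀ n → coef (0# ∷ []) n ≡ 0#
    zero-list zero    = refl
    zero-list (suc n) = refl

  mulR-top : ∀ x xs y ys → coef (mulR (x ∷ xs) (y ∷ ys)) (length xs ℕ.+ length ys)
                           ≡ coef (x ∷ xs) (length xs) * coef (y ∷ ys) (length ys)
  mulR-top x [] y ys = trans (at (mulR-constˡ x (y ∷ ys)) (length ys)) (coef-scale x (y ∷ ys) (length ys))
  mulR-top x (x' ∷ xs) y ys = begin
    coef (mulR (x ∷ x' ∷ xs) (y ∷ ys)) (suc i)
      ≡⟨ coef-mulR-∷ x (x' ∷ xs) (y ∷ ys) (suc i) ⟩
    x * coef ys i + coef (mulR (x' ∷ xs) (y ∷ ys)) i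
      ≡⟨ cong (λ c → x * c + coef (mulR (x' ∷ xs) (y ∷ ys)) i) (coef-beyond ys (ℕₚ.m≤n+m (length ys) (length xs))) ⟩
    x * 0# + coef (mulR (x' ∷ xs) (y ∷ ys)) i
      ≡⟨ trans (cong (_+ coef (mulR (x' ∷ xs) (y ∷ ys)) i) (zeroʳ x)) (+-identityˡ _) ⟩
    coef (mulR (x' ∷ xs) (y ∷ ys)) i
      ≡⟨ mulR-top x' xs y ys ⟩
    coef (x' ∷ xs) (length xs) * coef (y ∷ ys) (length ys) ∎
    where i = length xs ℕ.+ length ys

  isZero⇒≡0 : ∀ {x} → T (isZero x) → x ≡ 0#
  isZero⇒≡0 {x} t with x ≟ 0#
  ... | yes x≡0 = x≡0

  ¬isZero⇒≢0 : ∀ {x} → T (not (isZero x)) → x ≢ 0#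
  ¬isZero⇒≢0 {x} t x≡0 with x ≟ 0#
  ... | no x≢0 = x≢0 x≡0

  coef-trim : ∀ xs → trim xs ≈ xs
  coef-trim [] = ≈-refl
  coef-trim (x ∷ xs) with trim xs | coef-trim xs
  ... | y ∷ ys | e = ∷-cong e
  ... | []     | e with isZero x in isZero-x
  ...   | true  = pointwise λ { zero → sym (isZero⇒≡0 (subst T (sym isZero-x) tt)) ; (suc n) → at e n }
  ...   | false = ∷-cong e

  normal-tail : ∀ x xs → T (normal (x ∷ xs)) → T (normal xs)
  normal-tail x []       _ = tt
  normal-tail x (y ∷ ys) t = t

  normal-nonzero : ∀ x xs → T (normal (x ∷ xs)) → ¬ (∀ n → coef (x ∷ xs) n ≡ 0#)
  normal-nonzero x []       t z = ¬isZero⇒≢0 t (z 0)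
  normal-nonzero x (y ∷ ys) t z = normal-nonzero y ys t (λ n → z (suc n))

  normal-unique : ∀ xs ys → T (normal xs) → T (normal ys) → xs ≈ ys → xs ≡ ys
  normal-unique []       []       _  _  _ = refl
  normal-unique []       (y ∷ ys) _  ty e = ⊥-elim (normal-nonzero y ys ty (λ n → sym (at e n)))
  normal-unique (x ∷ xs) []       tx _  e = ⊥-elim (normal-nonzero x xs tx (at e))
  normal-unique (x ∷ xs) (y ∷ ys) tx ty e = cong₂ _∷_ (at e 0)
    (normal-unique xs ys (normal-tail x xs tx) (normal-tail y ys ty) (pointwise λ n → at e (suc n)))

  normal-length-≤ : ∀ xs k → T (normal xs) → (∀ n → k ≤ n → coef xs n ≡ 0#) → length xs ≤ k
  normal-length-≤ []       k       _ _ = z≤n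
  normal-length-≤ (x ∷ xs) zero    t z = ⊥-elim (normal-nonzero x xs t (λ n → z n z≤n))
  normal-length-≤ (x ∷ xs) (suc k) t z =
    s≤s (normal-length-≤ xs k (normal-tail x xs t) (λ n k≤n → z (suc n) (s≤s k≤n)))

  coeff : Poly → ℕ → C
  coeff p = coef (coeffs p)

  poly-ext : ∀ {p r} → coeffs p ≈ coeffs r → p ≡ r
  poly-ext {poly xs tx} {poly ys ty} e with normal-unique xs ys tx ty e
  ... | refl = cong (poly xs) (T-irrelevant tx ty)

  coeff-mk : ∀ xs n → coeff (mk xs) n ≡ coef xs n
  coeff-mk xs = at (coef-trim xs)

  coeff-⊕ : ∀ p r n → coeff (p ⊕ r) n ≡ coeff p n + coeff r n
  coeff-⊕ p r n = trans (coeff-mk (addR (coeffs p) (coeffs r)) n) (coef-addR (coeffs p) (coeffs r) n)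

  coeff-⊝ : ∀ p n → coeff (⊝ p) n ≡ - coeff p n
  coeff-⊝ p n = trans (coeff-mk (map -_ (coeffs p)) n) (coef-map -_ -0#≈0# (coeffs p) n)

  coeff-⊖ : ∀ p r n → coeff (p ⊖ r) n ≡ coeff p n + - coeff r n
  coeff-⊖ p r n = trans (coeff-⊕ p (⊝ r) n) (cong (coeff p n +_) (coeff-⊝ r n))

  ⊛-coeffs : ∀ p r → coeffs (p ⊛ r) ≈ mulR (coeffs p) (coeffs r)
  ⊛-coeffs p r = coef-trim (mulR (coeffs p) (coeffs r))

  -- Polynomials form a commutative ring: the laws of ⊕ hold coefficientwise,
  -- those of ⊛ are inherited from mulR.

  1p : Poly
  1p = mk (1# ∷ [])

  ⊕-assoc : ∀ p r s → (p ⊕ r) ⊕ s ≡ p ⊕ (r ⊕ s)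
  ⊕-assoc p r s = poly-ext (pointwise λ n → begin
    coeff ((p ⊕ r) ⊕ s) n                ≡⟨ trans (coeff-⊕ (p ⊕ r) s n) (cong (_+ coeff s n) (coeff-⊕ p r n)) ⟩
    (coeff p n + coeff r n) + coeff s n  ≡⟨ +-assoc _ _ _ ⟩
    coeff p n + (coeff r n + coeff s n)  ≡⟨ trans (coeff-⊕ p (r ⊕ s) n) (cong (coeff p n +_) (coeff-⊕ r s n)) ⟨
    coeff (p ⊕ (r ⊕ s)) n                ∎)

  ⊕-comm : ∀ p r → p ⊕ r ≡ r ⊕ p
  ⊕-comm p r = poly-ext (pointwise λ n →
    trans (coeff-⊕ p r n) (trans (+-comm _ _) (sym (coeff-⊕ r p n))))

  ⊕-identityˡ : ∀ p → 0p ⊕ p ≡ p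
  ⊕-identityˡ p = poly-ext (pointwise λ n → trans (coeff-⊕ 0p p n) (+-identityˡ _))

  ⊕-inverseʳ : ∀ p → p ⊕ (⊝ p) ≡ 0p
  ⊕-inverseʳ p = poly-ext (pointwise λ n → trans (coeff-⊖ p p n) (-‿inverseʳ _))

  ⊛-comm : ∀ p r → p ⊛ r ≡ r ⊛ p
  ⊛-comm p r = poly-ext (≈-trans (⊛-coeffs p r) (≈-trans (mulR-comm (coeffs p) (coeffs r)) (≈-sym (⊛-coeffs r p))))

  ⊛-assoc : ∀ p r s → (p ⊛ r) ⊛ s ≡ p ⊛ (r ⊛ s)
  ⊛-assoc p r s = poly-ext
    (≈-trans (⊛-coeffs (p ⊛ r) s) (≈-trans (mulR-congˡ (coeffs s) (⊛-coeffs p r))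
    (≈-trans (mulR-assoc (coeffs p) (coeffs r) (coeffs s))
    (≈-sym (≈-trans (⊛-coeffs p (r ⊛ s)) (mulR-congʳ (coeffs p) (⊛-coeffs r s)))))))

  ⊛-identityˡ : ∀ p → 1p ⊛ p ≡ p
  ⊛-identityˡ p = poly-ext
    (≈-trans (⊛-coeffs 1p p) (≈-trans (mulR-congˡ (coeffs p) (coef-trim (1# ∷ [])))
    (≈-trans (mulR-constˡ 1# (coeffs p)) (pointwise λ n → trans (coef-scale 1# (coeffs p) n) (*-identityˡ _)))))

  ⊛-distribʳ : ∀ s p r → (p ⊕ r) ⊛ s ≡ (p ⊛ s) ⊕ (r ⊛ s)
  ⊛-distribʳ s p r = poly-ext
    (≈-trans (⊛-coeffs (p ⊕ r) s) (≈-trans (mulR-congˡ (coeffs s) (coef-trim (addR (coeffs p) (coeffs r))))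
    (≈-trans (mulR-distribʳ (coeffs p) (coeffs r) (coeffs s))
    (≈-sym (≈-trans (coef-trim (addR (coeffs (p ⊛ s)) (coeffs (r ⊛ s)))) (addR-cong (⊛-coeffs p s) (⊛-coeffs r s)))))))

  Poly-isCommutativeRing : IsCommutativeRing _≡_ _⊕_ _⊛_ ⊝_ 0p 1p
  Poly-isCommutativeRing = record
    { isRing = record
      { +-isAbelianGroup = record
        { isGroup = record
          { isMonoid = record
            { isSemigroup = record
              { isMagma = record { isEquivalence = isEquivalence ; ∙-cong = cong₂ _⊕_ }
              ; assoc   = ⊕-assoc
              }
            ; identity = ⊕-identityˡ , λ p → trans (⊕-comm p 0p) (⊕-identityˡ p)
            }
          ; inverse = (λ p → trans (⊕-comm (⊝ p) p) (⊕-inverseʳ p)) , ⊕-inverseʳ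
          ; ⁻¹-cong = cong ⊝_
          }
        ; comm = ⊕-comm
        }
      ; *-cong     = cong₂ _⊛_
      ; *-assoc    = ⊛-assoc
      ; *-identity = ⊛-identityˡ , λ p → trans (⊛-comm p 1p) (⊛-identityˡ p)
      ; distrib    = (λ s p r → trans (⊛-comm s (p ⊕ r)) (trans (⊛-distribʳ s p r)
                                  (cong₂ _⊕_ (⊛-comm p s) (⊛-comm r s))))
                   , ⊛-distribʳ
      }
    ; *-comm = ⊛-comm
    }

  Poly-ring : CommutativeRing _ _
  Poly-ring = record { isCommutativeRing = Poly-isCommutativeRing }
  open CommutativeRing Poly-ring using ()
    renaming (zeroˡ to ⊛-zeroˡ; zeroʳ to ⊛-zeroʳ; +-identityʳ to ⊕-identityʳ; *-identityʳ to ⊛-identityʳ)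
  open import Algebra.Properties.Group (CommutativeRing.+-group Poly-ring)
    using () renaming (//-rightDividesˡ to ⊖-⊕-cancel; //-rightDividesʳ to ⊕-⊖-cancel; x∙y⁻¹≈ε⇒x≈y to ⊖≡0⇒≡)

  module Poly-Solver = SemiringSolver (CommutativeRing.commutativeSemiring Poly-ring)
  open Poly-Solver using () renaming (_:=_ to _⊜ₚ_; _:+_ to _:⊕_; _:*_ to _:⊛_)

  coeff-beyond : ∀ p {n} → len p ≤ n → coeff p n ≡ 0#
  coeff-beyond p = coef-beyond (coeffs p)

  len-≤ : ∀ p k → (∀ n → k ≤ n → coeff p n ≡ 0#) → len p ≤ k
  len-≤ p k = normal-length-≤ (coeffs p) k (isNormal p)

  len-≤-shifted : ∀ p e k → (∀ j → k ≤ j → coeff p (e ℕ.+ j) ≡ 0#) → len p ≤ e ℕ.+ k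
  len-≤-shifted p e k vanish = len-≤ p (e ℕ.+ k) λ n e+k≤n →
    let e≤n   = ℕₚ.≤-trans (ℕₚ.m≤m+n e k) e+k≤n
        n≡e+j = sym (ℕₚ.m+[n∸m]≡n e≤n)
    in subst (λ i → coeff p i ≡ 0#) (sym n≡e+j)
         (vanish (n ∸ e) (ℕₚ.+-cancelˡ-≤ e k (n ∸ e) (subst (e ℕ.+ k ≤_) n≡e+j e+k≤n)))

  coeff≢0⇒<len : ∀ p {n} → coeff p n ≢ 0# → n < len p
  coeff≢0⇒<len p {n} c≢0 with n <? len p
  ... | yes n<len = n<len
  ... | no  n≮len = ⊥-elim (c≢0 (coeff-beyond p (ℕₚ.≮⇒≥ n≮len)))

  nonzero⇒len>0 : ∀ p → p ≢ 0p → 0 < len p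
  nonzero⇒len>0 (poly []      _) p≢0 = ⊥-elim (p≢0 refl)
  nonzero⇒len>0 (poly (_ ∷ _) _) _   = s≤s z≤n

  lastR-coef : ∀ x xs → lastR (x ∷ xs) ≡ coef (x ∷ xs) (length xs)
  lastR-coef x []       = refl
  lastR-coef x (y ∷ ys) = lastR-coef y ys

  lead-coeff : ∀ p → lead p ≡ coeff p (pred (len p))
  lead-coeff (poly []       _) = refl
  lead-coeff (poly (x ∷ xs) _) = lastR-coef x xs

  lead≢0 : ∀ p → p ≢ 0p → lead p ≢ 0#
  lead≢0 (poly []       _) p≢0 = ⊥-elim (p≢0 refl)
  lead≢0 p@(poly (x ∷ xs) _) _ lead≡0 = ℕₚ.n≮n (length xs) (len-≤ p (length xs) vanish)
    where
    vanish : ∀ n → length xs ≤ n → coeff p n ≡ 0#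
    vanish n lx≤n with ℕₚ.m≤n⇒m<n∨m≡n lx≤n
    ... | inj₁ lx<n = coeff-beyond p lx<n
    ... | inj₂ refl = trans (sym (lead-coeff p)) lead≡0

  -- deg (p ⊛ r) = deg p + deg r over a field; we need the consequence deg r ≤ deg (p ⊛ r).
  len-⊛ : ∀ p r → p ≢ 0p → r ≢ 0p → len r ≤ len (p ⊛ r)
  len-⊛ (poly [] _) r p≢0 _   = ⊥-elim (p≢0 refl)
  len-⊛ p (poly [] _) _   r≢0 = ⊥-elim (r≢0 refl)
  len-⊛ p@(poly (x ∷ xs) _) r@(poly (y ∷ ys) _) p≢0 r≢0 =
    ℕₚ.≤-<-trans (ℕₚ.m≤n+m (length ys) (length xs)) (coeff≢0⇒<len (p ⊛ r) top≢0)
    where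
    top : coeff (p ⊛ r) (length xs ℕ.+ length ys) ≡ lead p * lead r
    top = trans (at (⊛-coeffs p r) _)
      (trans (mulR-top x xs y ys) (sym (cong₂ _*_ (lead-coeff p) (lead-coeff r))))
    top≢0 : coeff (p ⊛ r) (length xs ℕ.+ length ys) ≢ 0#
    top≢0 = subst (_≢ 0#) (sym top) (*-nonzero (lead≢0 p p≢0) (lead≢0 r r≢0))

  ⊛-nonzero : ∀ p r → p ≢ 0p → r ≢ 0p → p ⊛ r ≢ 0p
  ⊛-nonzero p r p≢0 r≢0 pr≡0 =
    ℕₚ.<⇒≱ (nonzero⇒len>0 r r≢0) (subst (λ s → len r ≤ len s) pr≡0 (len-⊛ p r p≢0 r≢0))

  len-⊖ : ∀ a b k → len a ≤ k → len b ≤ k → len (a ⊖ b) ≤ k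
  len-⊖ a b k la≤k lb≤k = len-≤ (a ⊖ b) k λ n k≤n → begin
    coeff (a ⊖ b) n             ≡⟨ coeff-⊖ a b n ⟩
    coeff a n + - coeff b n     ≡⟨ cong₂ (λ u v → u + - v) (coeff-beyond a (ℕₚ.≤-trans la≤k k≤n))
                                                           (coeff-beyond b (ℕₚ.≤-trans lb≤k k≤n)) ⟩
    0# + - 0#                   ≡⟨ -‿inverseʳ 0# ⟩
    0#                          ∎

  coeff-monomial-⊛ : ∀ c e b j → coeff (monomial c e ⊛ b) (e ℕ.+ j) ≡ c * coeff b j
  coeff-monomial-⊛ c e b j = begin
    coeff (monomial c e ⊛ b) (e ℕ.+ j)              ≡⟨ at (⊛-coeffs (monomial c e) b) (e ℕ.+ j) ⟩
    coef (mulR (coeffs (monomial c e)) B) (e ℕ.+ j) ≡⟨ at (mulR-congˡ B (coef-trim (replicate e 0# ++ c ∷ []))) (e ℕ.+ j) ⟩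
    coef (mulR (replicate e 0# ++ c ∷ []) B) (e ℕ.+ j) ≡⟨ shifted e ⟩
    coef (mulR (c ∷ []) B) j                        ≡⟨ at (mulR-constˡ c B) j ⟩
    coef (map (c *_) B) j                           ≡⟨ coef-scale c B j ⟩
    c * coeff b j                                   ∎
    where
    B = coeffs b
    shifted : ∀ e → coef (mulR (replicate e 0# ++ c ∷ []) B) (e ℕ.+ j) ≡ coef (mulR (c ∷ []) B) j
    shifted zero    = refl
    shifted (suc e) = trans (at (mulR-shiftˡ (replicate e 0# ++ c ∷ []) B) (suc (e ℕ.+ j))) (shifted e)

  cancelling-term : Poly → Poly → Poly
  cancelling-term b r = monomial (lead r * (lead b ⁻¹)) (len r ∸ len b)

  -- That step kills the leading coefficient of r, so it lowers len r.
  cancel-lowers-len : ∀ b r → b ≢ 0p → len b ≤ len r → len (r ⊖ (cancelling-term b r ⊛ b)) < len r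
  cancel-lowers-len (poly [] _) r b≢0 _ = ⊥-elim (b≢0 refl)
  cancel-lowers-len b@(poly (y ∷ ys) _) r@(poly (x ∷ xs) _) b≢0 (s≤s ly≤lx) =
    s≤s (subst (len (r ⊖ (t ⊛ b)) ≤_) e+ly≡lx (len-≤-shifted (r ⊖ (t ⊛ b)) e ly vanish-shifted))
    where
    lx = length xs
    ly = length ys
    c  = lead r * (lead b ⁻¹)
    e  = lx ∸ ly
    t  = cancelling-term b r
    e+ly≡lx : e ℕ.+ ly ≡ lx
    e+ly≡lx = ℕₚ.m∸n+n≡m ly≤lx
    c*lead-b : c * lead b ≡ lead r
    c*lead-b = trans (*-assoc _ _ _)
      (trans (cong (lead r *_) (trans (*-comm _ _) (*-inverse (lead b) (lead≢0 b b≢0)))) (*-identityʳ _))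
    shifted-coeff : ∀ j → coeff (r ⊖ (t ⊛ b)) (e ℕ.+ j) ≡ coeff r (e ℕ.+ j) + - (c * coeff b j)
    shifted-coeff j = trans (coeff-⊖ r (t ⊛ b) (e ℕ.+ j))
                            (cong (λ u → coeff r (e ℕ.+ j) + - u) (coeff-monomial-⊛ c e b j))
    vanish-shifted : ∀ j → ly ≤ j → coeff (r ⊖ (t ⊛ b)) (e ℕ.+ j) ≡ 0#
    vanish-shifted j ly≤j with ℕₚ.m≤n⇒m<n∨m≡n ly≤j
    ... | inj₂ refl = begin
      coeff (r ⊖ (t ⊛ b)) (e ℕ.+ ly)         ≡⟨ shifted-coeff ly ⟩
      coeff r (e ℕ.+ ly) + - (c * coeff b ly) ≡⟨ cong₂ (λ u v → u + - (c * v))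
                                                   (trans (cong (coeff r) e+ly≡lx) (sym (lead-coeff r)))
                                                   (sym (lead-coeff b)) ⟩
      lead r + - (c * lead b)                 ≡⟨ cong (λ u → lead r + - u) c*lead-b ⟩
      lead r + - lead r                       ≡⟨ -‿inverseʳ _ ⟩
      0#                                      ∎
    ... | inj₁ ly<j = begin
      coeff (r ⊖ (t ⊛ b)) (e ℕ.+ j)       ≡⟨ shifted-coeff j ⟩
      coeff r (e ℕ.+ j) + - (c * coeff b j)
        ≡⟨ cong₂ (λ u v → u + - (c * v))
             (coeff-beyond r (subst (ℕ._≤ e ℕ.+ j) (trans (ℕₚ.+-suc e ly) (cong suc e+ly≡lx)) (ℕₚ.+-monoʳ-≤ e ly<j)))
             (coeff-beyond b ly<j) ⟩
      0# + - (c * 0#)                     ≡⟨ trans (+-identityˡ _) (trans (cong -_ (zeroʳ c)) -0#≈0#) ⟩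
      0#                                  ∎

  divModAux-invariant : ∀ f b qu r →
    (qu ⊛ b) ⊕ r ≡ (proj₁ (divModAux f b qu r) ⊛ b) ⊕ proj₂ (divModAux f b qu r)
  divModAux-invariant zero    b qu r = refl
  divModAux-invariant (suc f) b qu r with len r <? len b
  ... | yes _ = refl
  ... | no  _ = trans (step qu (cancelling-term b r) b r) (divModAux-invariant f b _ _)
    where
    step : ∀ qu t b r → (qu ⊛ b) ⊕ r ≡ ((qu ⊕ t) ⊛ b) ⊕ (r ⊖ (t ⊛ b))
    step qu t b r = begin
      (qu ⊛ b) ⊕ r                              ≡⟨ cong ((qu ⊛ b) ⊕_) (⊖-⊕-cancel (t ⊛ b) r) ⟨
      (qu ⊛ b) ⊕ ((r ⊖ (t ⊛ b)) ⊕ (t ⊛ b))      ≡⟨ rearrange (qu ⊛ b) (t ⊛ b) (r ⊖ (t ⊛ b)) ⟩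
      ((qu ⊛ b) ⊕ (t ⊛ b)) ⊕ (r ⊖ (t ⊛ b))      ≡⟨ cong (_⊕ (r ⊖ (t ⊛ b))) (⊛-distribʳ b qu t) ⟨
      ((qu ⊕ t) ⊛ b) ⊕ (r ⊖ (t ⊛ b))            ∎
      where
      rearrange : ∀ a c s → a ⊕ (s ⊕ c) ≡ (a ⊕ c) ⊕ s
      rearrange = Poly-Solver.solve 3 (λ a c s → (a :⊕ (s :⊕ c)) ⊜ₚ ((a :⊕ c) :⊕ s)) refl

  divModAux-len : ∀ f b qu r → b ≢ 0p → len r < f ℕ.+ len b → len (proj₂ (divModAux f b qu r)) < len b
  divModAux-len zero    b qu r _   r<b = r<b
  divModAux-len (suc f) b qu r b≢0 r<f+b with len r <? len b
  ... | yes r<b = r<b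
  ... | no  r≮b = divModAux-len f b _ _ b≢0
    (ℕₚ.<-≤-trans (cancel-lowers-len b r b≢0 (ℕₚ.≮⇒≥ r≮b)) (ℕₚ.≤-pred r<f+b))

  division : ∀ a b → a ≡ (quot a b ⊛ b) ⊕ rem a b
  division a b = trans (sym (trans (cong (_⊕ a) (⊛-zeroˡ b)) (⊕-identityˡ a))) (divModAux-invariant (suc (len a)) b 0p a)

  rem-len : ∀ a b → b ≢ 0p → rem a b deg< b
  rem-len a b b≢0 = divModAux-len (suc (len a)) b 0p a b≢0 (s≤s (ℕₚ.m≤m+n (len a) (len b)))

  _≟0p : ∀ p → Dec (p ≡ 0p)
  poly []      _ ≟0p = yes refl
  poly (_ ∷ _) _ ≟0p = no λ ()

  division-difference : ∀ {b q₁ r₁ q₂ r₂} → (q₁ ⊛ b) ⊕ r₁ ≡ (q₂ ⊛ b) ⊕ r₂ → ((q₁ ⊖ q₂) ⊛ b) ⊕ r₁ ≡ r₂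
  division-difference {b} {q₁} {r₁} {q₂} {r₂} eq = begin
    (d ⊛ b) ⊕ r₁                        ≡⟨ ⊕-⊖-cancel (q₂ ⊛ b) _ ⟨
    (((d ⊛ b) ⊕ r₁) ⊕ (q₂ ⊛ b)) ⊖ (q₂ ⊛ b) ≡⟨ cong (_⊖ (q₂ ⊛ b)) (regroup d q₂ b r₁) ⟩
    (((d ⊕ q₂) ⊛ b) ⊕ r₁) ⊖ (q₂ ⊛ b)      ≡⟨ cong (λ q → ((q ⊛ b) ⊕ r₁) ⊖ (q₂ ⊛ b)) (⊖-⊕-cancel q₂ q₁) ⟩
    ((q₁ ⊛ b) ⊕ r₁) ⊖ (q₂ ⊛ b)            ≡⟨ cong (_⊖ (q₂ ⊛ b)) (trans eq (⊕-comm (q₂ ⊛ b) r₂)) ⟩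
    (r₂ ⊕ (q₂ ⊛ b)) ⊖ (q₂ ⊛ b)            ≡⟨ ⊕-⊖-cancel (q₂ ⊛ b) r₂ ⟩
    r₂                                  ∎
    where
    d = q₁ ⊖ q₂
    regroup : ∀ d q b r → ((d ⊛ b) ⊕ r) ⊕ (q ⊛ b) ≡ ((d ⊕ q) ⊛ b) ⊕ r
    regroup = Poly-Solver.solve 4 (λ d q b r → ((d :⊛ b :⊕ r) :⊕ (q :⊛ b)) ⊜ₚ ((d :⊕ q) :⊛ b :⊕ r)) refl

  -- Quotient and remainder are unique: a nonzero q₁ - q₂ would make
  -- (q₁ - q₂) b = r₂ - r₁ at least as long as b.
  division-unique : ∀ {b q₁ r₁ q₂ r₂} → b ≢ 0p → r₁ deg< b → r₂ deg< b →
    (q₁ ⊛ b) ⊕ r₁ ≡ (q₂ ⊛ b) ⊕ r₂ → q₁ ≡ q₂ × r₁ ≡ r₂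
  division-unique {b} {q₁} {r₁} {q₂} {r₂} b≢0 r₁<b r₂<b eq with (q₁ ⊖ q₂) ≟0p
  ... | yes d≡0 = ⊖≡0⇒≡ q₁ q₂ d≡0 , (begin
    r₁                         ≡⟨ trans (cong (_⊕ r₁) (⊛-zeroˡ b)) (⊕-identityˡ r₁) ⟨
    (0p ⊛ b) ⊕ r₁              ≡⟨ cong (λ d → (d ⊛ b) ⊕ r₁) d≡0 ⟨
    ((q₁ ⊖ q₂) ⊛ b) ⊕ r₁       ≡⟨ division-difference {b} {q₁} {r₁} {q₂} {r₂} eq ⟩
    r₂                         ∎)
  ... | no  d≢0 = ⊥-elim (ℕₚ.<⇒≱ difference<b b≤difference)
    where
    b≤difference : len b ≤ len (r₂ ⊖ r₁)
    b≤difference = subst (λ p → len b ≤ len p)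
      (trans (sym (⊕-⊖-cancel r₁ ((q₁ ⊖ q₂) ⊛ b)))
             (cong (_⊖ r₁) (division-difference {b} {q₁} {r₁} {q₂} {r₂} eq)))
      (len-⊛ (q₁ ⊖ q₂) b d≢0 b≢0)
    difference<b : len (r₂ ⊖ r₁) < len b
    difference<b = ℕₚ.m≤pred[n]⇒suc[m]≤n {{ℕ.>-nonZero (nonzero⇒len>0 b b≢0)}}
                     (len-⊖ r₂ r₁ _ (ℕₚ.<⇒≤pred r₂<b) (ℕₚ.<⇒≤pred r₁<b))

  -- Congruence modulo a polynomial, oriented so that no cancellation is needed:
  -- a ≅ b mod R when a = b + R u for some u.

  infix 4 _≅_mod_
  record _≅_mod_ (a b R : Poly) : Set where
    constructor _,_
    field
      multiplier : Poly
      equation   : a ≡ b ⊕ (R ⊛ multiplier)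

  ≡⇒mod : ∀ {R a b} → a ≡ b → a ≅ b mod R
  ≡⇒mod {R} {a} refl = 0p , sym (trans (cong (a ⊕_) (⊛-zeroʳ R)) (⊕-identityʳ a))

  mod-trans : ∀ {R a b c} → a ≅ b mod R → b ≅ c mod R → a ≅ c mod R
  mod-trans {R} {c = c} (u , refl) (v , refl) = v ⊕ u ,
    Poly-Solver.solve 4 (λ c R u v → ((c :⊕ R :⊛ v) :⊕ R :⊛ u) ⊜ₚ (c :⊕ R :⊛ (v :⊕ u))) refl c R u v

  mod-⊕ : ∀ {R a a' b b'} → a ≅ a' mod R → b ≅ b' mod R → a ⊕ b ≅ a' ⊕ b' mod R
  mod-⊕ {R} {a' = a'} {b' = b'} (u , refl) (v , refl) = u ⊕ v ,
    Poly-Solver.solve 5 (λ a' b' R u v → ((a' :⊕ R :⊛ u) :⊕ (b' :⊕ R :⊛ v)) ⊜ₚ ((a' :⊕ b') :⊕ R :⊛ (u :⊕ v)))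
      refl a' b' R u v

  mod-⊛ : ∀ {R a a'} c → a ≅ a' mod R → c ⊛ a ≅ c ⊛ a' mod R
  mod-⊛ {R} {a' = a'} c (u , refl) = c ⊛ u ,
    Poly-Solver.solve 4 (λ c a' R u → (c :⊛ (a' :⊕ R :⊛ u)) ⊜ₚ (c :⊛ a' :⊕ R :⊛ (c :⊛ u))) refl c a' R u

  mod-rem : ∀ a b → a ≅ rem a b mod b
  mod-rem a b = quot a b ,
    trans (division a b) (trans (⊕-comm (quot a b ⊛ b) (rem a b)) (cong (rem a b ⊕_) (⊛-comm (quot a b) b)))

  quot-mod : ∀ {b c a a'} → b ≢ 0p → a ≅ a' mod b ⊛ c → quot a b ≅ quot a' b mod c × rem a b ≡ rem a' b
  quot-mod {b} {c} {a} {a'} b≢0 (u , a≡a'+bcu) with division-unique b≢0 (rem-len a b b≢0) (rem-len a' b b≢0) divisions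
    where
    divisions : (quot a b ⊛ b) ⊕ rem a b ≡ ((quot a' b ⊕ (c ⊛ u)) ⊛ b) ⊕ rem a' b
    divisions = begin
      (quot a b ⊛ b) ⊕ rem a b                  ≡⟨ division a b ⟨
      a                                         ≡⟨ a≡a'+bcu ⟩
      a' ⊕ ((b ⊛ c) ⊛ u)                        ≡⟨ cong (_⊕ ((b ⊛ c) ⊛ u)) (division a' b) ⟩
      ((quot a' b ⊛ b) ⊕ rem a' b) ⊕ ((b ⊛ c) ⊛ u)
        ≡⟨ Poly-Solver.solve 5 (λ q r b c u → ((q :⊛ b :⊕ r) :⊕ (b :⊛ c) :⊛ u) ⊜ₚ ((q :⊕ c :⊛ u) :⊛ b :⊕ r))
             refl (quot a' b) (rem a' b) b c u ⟩
      ((quot a' b ⊕ (c ⊛ u)) ⊛ b) ⊕ rem a' b    ∎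
  ... | quot≡ , rem≡ = (u , quot≡) , rem≡

  _^ₚ_ : Poly → ℕ → Poly
  p ^ₚ zero  = 1p
  p ^ₚ suc k = p ⊛ (p ^ₚ k)

  1p≢0p : 1p ≢ 0p
  1p≢0p 1≡0 = 0≢1 (sym (trans (sym (coeff-mk (1# ∷ []) 0)) (cong (λ p → coeff p 0) 1≡0)))

  ^-nonzero : ∀ p → p ≢ 0p → ∀ k → p ^ₚ k ≢ 0p
  ^-nonzero p p≢0 zero    = 1p≢0p
  ^-nonzero p p≢0 (suc k) = ⊛-nonzero p (p ^ₚ k) p≢0 (^-nonzero p p≢0 k)

  wSeq-shift : ∀ P Q w i → wSeq P Q w (suc i) ≡ wSeq P Q (quot (Q ⊛ w) P) i
  wSeq-shift P Q w zero    = refl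
  wSeq-shift P Q w (suc i) = cong (λ v → quot (Q ⊛ v) P) (wSeq-shift P Q w i)

  digit-shift : ∀ P Q m w → digit P Q (suc m) w ≡ digit P Q m (quot (Q ⊛ w) P)
  digit-shift P Q m w = cong (λ v → rem (Q ⊛ v) P) (wSeq-shift P Q w m)

  -- A congruence
  -- modulo P^(m+1) between w and w' becomes one modulo P^m between w₁ and w₁',
  -- and congruence modulo P gives equal remainders of Q w and Q w'.
  digit-mod : ∀ P Q → P ≢ 0p → ∀ m {w w'} → w ≅ w' mod P ^ₚ suc m → digit P Q m w ≡ digit P Q m w'
  digit-mod P Q P≢0 zero          w≅w' = proj₂ (quot-mod {c = 1p} P≢0 (mod-⊛ Q w≅w'))
  digit-mod P Q P≢0 (suc m) {w} {w'} w≅w' = begin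
    digit P Q (suc m) w                 ≡⟨ digit-shift P Q m w ⟩
    digit P Q m (quot (Q ⊛ w) P)        ≡⟨ digit-mod P Q P≢0 m (proj₁ (quot-mod P≢0 (mod-⊛ Q w≅w'))) ⟩
    digit P Q m (quot (Q ⊛ w') P)       ≡⟨ digit-shift P Q m w' ⟨
    digit P Q (suc m) w'                ∎

  X : Poly
  X = mk (0# ∷ 1# ∷ [])

  constant : C → Poly
  constant c = mk (c ∷ [])

  X-⊛ : ∀ p → coeffs (X ⊛ p) ≈ 0# ∷ coeffs p
  X-⊛ p = ≈-trans (⊛-coeffs X p) (≈-trans (mulR-congˡ (coeffs p) (coef-trim (0# ∷ 1# ∷ [])))
    (≈-trans (mulR-shiftˡ (1# ∷ []) (coeffs p)) (∷-cong (≈-trans (mulR-constˡ 1# (coeffs p))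
    (pointwise λ n → trans (coef-scale 1# (coeffs p) n) (*-identityˡ _))))))

  mk-∷ : ∀ c cs → mk (c ∷ cs) ≡ constant c ⊕ (X ⊛ mk cs)
  mk-∷ c cs = poly-ext (pointwise λ n → begin
    coeff (mk (c ∷ cs)) n                          ≡⟨ coeff-mk (c ∷ cs) n ⟩
    coef (c ∷ cs) n                                ≡⟨ split n ⟩
    coeff (constant c) n + coef (0# ∷ coeffs (mk cs)) n
                                                   ≡⟨ cong (coeff (constant c) n +_) (at (X-⊛ (mk cs)) n) ⟨
    coeff (constant c) n + coeff (X ⊛ mk cs) n     ≡⟨ coeff-⊕ (constant c) (X ⊛ mk cs) n ⟨
    coeff (constant c ⊕ (X ⊛ mk cs)) n             ∎)
    where
    split : ∀ n → coef (c ∷ cs) n ≡ coeff (constant c) n + coef (0# ∷ coeffs (mk cs)) n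
    split zero    = sym (trans (cong (_+ 0#) (coeff-mk (c ∷ []) 0)) (+-identityʳ c))
    split (suc n) = sym (trans (cong₂ _+_ (coeff-mk (c ∷ []) (suc n)) (coeff-mk cs n)) (+-identityˡ _))

  mk-coeffs : ∀ p → mk (coeffs p) ≡ p
  mk-coeffs p = poly-ext (coef-trim (coeffs p))

  -- Residues modulo a nonzero R, stored as coefficient vectors of length deg R.

  pad : ∀ k → List C → Vec C k
  pad zero    _        = Vec.[]
  pad (suc k) []       = 0# Vec.∷ pad k []
  pad (suc k) (x ∷ xs) = x Vec.∷ pad k xs

  coef-pad : ∀ k xs → length xs ≤ k → toList (pad k xs) ≈ xs
  coef-pad zero    []       _         = ≈-refl
  coef-pad (suc k) []       _         = pointwise λ { zero → refl ; (suc n) → at (coef-pad k [] z≤n) n }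
  coef-pad (suc k) (x ∷ xs) (s≤s le) = ∷-cong (coef-pad k xs le)

  module Residues (R : Poly) (R≢0 : R ≢ 0p) where

    Residue : Set
    Residue = Vec C (pred (len R))

    ⟦_⟧ : Residue → Poly
    ⟦ v ⟧ = mk (toList v)

    reduce : Poly → Residue
    reduce p = pad (pred (len R)) (coeffs (rem p R))

    ⟦reduce⟧ : ∀ p → ⟦ reduce p ⟧ ≡ rem p R
    ⟦reduce⟧ p = poly-ext (≈-trans (coef-trim (toList (reduce p)))
      (coef-pad (pred (len R)) (coeffs (rem p R)) (ℕₚ.<⇒≤pred (rem-len p R R≢0))))

    mod-reduce : ∀ p → p ≅ ⟦ reduce p ⟧ mod R
    mod-reduce p = subst (λ r → p ≅ r mod R) (sym (⟦reduce⟧ p)) (mod-rem p R)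

    -- The automaton state after reading w₀ … w_{i-1} is
    -- (X^i mod R , (w₀ + … + w_{i-1} X^{i-1}) mod R).
    State : Set
    State = Residue × Residue

    start : State
    start = reduce 1p , reduce 0p

    step : State → C → State
    step (x , y) c = reduce (X ⊛ ⟦ x ⟧) , reduce (⟦ y ⟧ ⊕ (constant c ⊛ ⟦ x ⟧))

    run-invariant : ∀ cs x y → ⟦ y ⟧ ⊕ (mk cs ⊛ ⟦ x ⟧) ≅ ⟦ proj₂ (foldl step (x , y) cs) ⟧ mod R
    run-invariant []       x y = ≡⇒mod (trans (cong (⟦ y ⟧ ⊕_) (⊛-zeroˡ ⟦ x ⟧)) (⊕-identityʳ ⟦ y ⟧))
    run-invariant (c ∷ cs) x y = mod-trans (≡⇒mod regroup)
      (mod-trans (mod-⊕ (mod-reduce _) (mod-⊛ (mk cs) (mod-reduce (X ⊛ ⟦ x ⟧))))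
                 (run-invariant cs (reduce (X ⊛ ⟦ x ⟧)) (reduce (⟦ y ⟧ ⊕ (constant c ⊛ ⟦ x ⟧)))))
      where
      regroup : ⟦ y ⟧ ⊕ (mk (c ∷ cs) ⊛ ⟦ x ⟧) ≡ (⟦ y ⟧ ⊕ (constant c ⊛ ⟦ x ⟧)) ⊕ (mk cs ⊛ (X ⊛ ⟦ x ⟧))
      regroup = trans (cong (λ p → ⟦ y ⟧ ⊕ (p ⊛ ⟦ x ⟧)) (mk-∷ c cs))
        (Poly-Solver.solve 5 (λ y c X w x → (y :⊕ (c :⊕ X :⊛ w) :⊛ x) ⊜ₚ ((y :⊕ c :⊛ x) :⊕ w :⊛ (X :⊛ x)))
          refl ⟦ y ⟧ (constant c) X (mk cs) ⟦ x ⟧)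

    residue-of-word : ∀ w → w ≅ ⟦ proj₂ (foldl step start (coeffs w)) ⟧ mod R
    residue-of-word w = mod-trans (≡⇒mod w≡0+w1)
      (mod-trans (mod-⊕ (mod-reduce 0p) (mod-⊛ (mk (coeffs w)) (mod-reduce 1p)))
                 (run-invariant (coeffs w) (reduce 1p) (reduce 0p)))
      where
      w≡0+w1 : w ≡ 0p ⊕ (mk (coeffs w) ⊛ 1p)
      w≡0+w1 = sym (trans (⊕-identityˡ _) (trans (⊛-identityʳ (mk (coeffs w))) (mk-coeffs w)))

  fold-automatic : ∀ {Δ S : Set} → Enumerable S → (s₀ : S) (step : S → C → S) (out : S → Δ) →
    (f : Poly → Δ) → (∀ w → out (foldl step s₀ (coeffs w)) ≡ f w) → Automatic f
  fold-automatic {Δ} {S} E s₀ step out f correct = A , λ w → trans (cong out (decode-run (coeffs w) s₀)) (correct w)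
    where
    open Enumerable E
    A : DFAO C Δ
    A = record { n = size ; init = encode s₀ ; δ = λ i c → encode (step (decode i) c) ; output = λ i → out (decode i) }
    decode-run : ∀ cs s → decode (foldl (DFAO.δ A) (encode s) cs) ≡ foldl step s cs
    decode-run []       s = decode-encode s
    decode-run (c ∷ cs) s = trans (decode-run cs (step (decode (encode s)) c))
                                  (cong (λ t → foldl step (step t c) cs) (decode-encode s))

  digit-automatic : ∀ P Q → P ≢ 0p → ∀ m → Automatic (digit P Q m)
  digit-automatic P Q P≢0 m =
    fold-automatic (enumerable-× residues residues) start step (λ s → digit P Q m ⟦ proj₂ s ⟧) (digit P Q m)
      (λ w → sym (digit-mod P Q P≢0 m (residue-of-word w)))
    where
    open Residues (P ^ₚ suc m) (^-nonzero P P≢0 (suc m))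
    residues : Enumerable Residue
    residues = enumerable-Vec (enumerable-↔ enumeration) (pred (len (P ^ₚ suc m)))

-- Theorem 3.5.
theorem3p5 : (𝔽 : FiniteField) → let open Polynomials 𝔽 in
    (P Q : Poly) → P ≢ 0p → Q ≢ 0p → Coprime P Q → Q deg< P →
    (m : ℕ) → Automatic (digit P Q m)
theorem3p5 𝔽 P Q P≢0 _ _ _ m = DigitAutomaticity.digit-automatic 𝔽 P Q P≢0 m
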